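{- Let $\Xi$ be a $(k,q,a,d)$-blurer, $K\subseteq[d]$ with $|K|=k$, and $\xi_{\mathsf{fix}}=(a,0,\dots,0)\in\mathbb{Z}_{2^q}^d$. Then every function $f\colon\Xi|_K\to\mathbb{F}_2$ (where $\Xi|_K=\{\xi|_K:\xi\in\Xi\}$) satisfies $\sum_{\xi\in\Xi}f(\xi|_K)=f(\xi_{\mathsf{fix}}|_K)$ (sum in $\mathbb{F}_2$).
   Context: For $\bar t\in\mathbb{Z}_{2^q}^d$ and $N\subseteq[d]$, $\bar t|_N$ is the restriction of $\bar t$ to the indices in $N$. For $\Xi\subseteq\mathbb{Z}_{2^q}^d$, $N\subseteq[d]$, $\bar b\in\mathbb{Z}_{2^q}^{|N|}$ let $\#_{N,\bar b}(\Xi)=|\{\bar c\in\Xi:\bar c|_N=\bar b\}|\bmod2$. For $d\ge k$ and $a\in\mathbb{Z}_{2^q}$, $\Xi\subseteq\mathbb{Z}_{2^q}^d$ is a $(k,q,a,d)$-blurer if for all $N\subseteq[d]$ with $|N|=k$: (1) $\sum_j\xi(j)=0$ for all $\xi\in\Xi$; (2) if $1\in N$ then $\#_{N,(a,0,\dots,0)}(\Xi)=1$; (3) if $1\notin N$ then $\#_{N,\bar0}(\Xi)=1$; (4) $\#_{N,\bar b}(\Xi)=0$ for all other pairs $N,\bar b$. (Tuples restricted to $N$ are indexed in increasing order of $N$.) -}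

module Defs where

open import Data.Nat using (ℕ; zero; suc; _+_; _^_; _%_)
open import Data.Nat.Properties using (m^n>0)
open import Data.Nat.Divisibility using (_∣_)
open import Data.Fin using (Fin; toℕ; fromℕ<)
open import Data.Fin.Properties using () renaming (_≟_ to _≟F_)
open import Data.Bool using (Bool; true; false; _xor_)
open import Data.Vec using (Vec; []; _∷_; replicate; foldr)
open import Data.Vec.Properties using (≡-dec)
open import Data.List using (List; length; filter)
import Data.List as L
open import Data.List.Relation.Unary.Unique.Propositional using (Unique)
open import Data.List.Membership.Propositional using (_∈_)
open import Relation.Binary.PropositionalEquality using (_≡_; _≢_)
open import Relation.Nullary using (Dec)

Zq : ℕ → Set
Zq q = Fin (2 ^ q)

0Z : (q : ℕ) → Zq q
0Z q = fromℕ< (m^n>0 2 q)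

Tuple : ℕ → ℕ → Set
Tuple q m = Vec (Zq q) m

-- Subsets N ⊆ [d] as characteristic vectors (position i = element i+1).
Subset : ℕ → Set
Subset d = Vec Bool d

size : {d : ℕ} → Subset d → ℕ
size [] = zero
size (true ∷ N) = suc (size N)
size (false ∷ N) = size N

restrict : {A : Set} {d : ℕ} → (N : Subset d) → Vec A d → Vec A (size N)
restrict [] [] = []
restrict (true ∷ N) (x ∷ t) = x ∷ restrict N t
restrict (false ∷ N) (x ∷ t) = restrict N t

fixT : (q m : ℕ) → Zq q → Tuple q m
fixT q zero a = []
fixT q (suc m) a = a ∷ replicate m (0Z q)

zeroT : (q m : ℕ) → Tuple q m
zeroT q m = replicate m (0Z q)

first∈ : {d : ℕ} → Subset d → Bool
first∈ [] = false
first∈ (b ∷ N) = b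

≟T : (q : ℕ) {m : ℕ} → (s t : Tuple q m) → Dec (s ≡ t)
≟T q = ≡-dec _≟F_

count# : (q : ℕ) {d : ℕ} → (N : Subset d) → Tuple q (size N) → List (Tuple q d) → ℕ
count# q N b Ξ = length (filter (λ c → ≟T q (restrict N c) b) Ξ) % 2

-- sum of the entries of a tuple, computed in ℕ (≡ 0 in ℤ_{2^q} iff 2^q divides it)
sumℕ : (q : ℕ) {m : ℕ} → Tuple q m → ℕ
sumℕ q = foldr _ (λ x s → toℕ x + s) 0

-- Ξ ⊆ ℤ_{2^q}^d is a finite set: a duplicate-free list.
-- (k,q,a,d)-blurer
record IsBlurer (k q : ℕ) (a : Zq q) (d : ℕ) (Ξ : List (Tuple q d)) : Set where
  field
    unique : Unique Ξ
    sum-zero : (ξ : Tuple q d) → ξ ∈ Ξ → (2 ^ q) ∣ sumℕ q ξ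
    cond-1∈N : (N : Subset d) → size N ≡ k → first∈ N ≡ true →
               count# q N (fixT q (size N) a) Ξ ≡ 1
    cond-1∉N : (N : Subset d) → size N ≡ k → first∈ N ≡ false →
               count# q N (zeroT q (size N)) Ξ ≡ 1
    cond-other : (N : Subset d) → size N ≡ k → (b : Tuple q (size N)) →
               (first∈ N ≡ true → b ≢ fixT q (size N) a) →
               (first∈ N ≡ false → b ≢ zeroT q (size N)) →
               count# q N b Ξ ≡ 0

sumF2 : (q : ℕ) {d : ℕ} → (K : Subset d) → (Tuple q (size K) → Bool) → List (Tuple q d) → Bool
sumF2 q K f Ξ = L.foldr (λ ξ s → f (restrict K ξ) xor s) false Ξ

-- Summing f(ξ|_K) over Ξ in 𝔽₂ only sees, for each value b, the parity of the number of
-- ξ ∈ Ξ with ξ|_K = b. The blurer conditions say this parity is odd for exactly one value,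
-- b₀ = ξ_fix|_K, so the sum collapses to f(b₀). Splitting off all occurrences of one value
-- at a time shows that a list in which every value occurs an even number of times sums to 0.
module Submission where

open import Defs
open import Data.Nat using (ℕ; _≥_; zero; suc; _%_; _≤_; _<_; s≤s)
open import Data.Nat.Properties using (≤-refl; ≤-trans; ≤-pred)
open import Data.Bool using (Bool; true; false; _xor_)
open import Data.Bool.Properties using (xor-assoc; xor-comm; xor-same; xor-identityʳ)
open import Data.List using (List; []; _∷_; length; filter; foldr)
open import Data.List.Properties using (filter-notAll)
open import Data.List.Relation.Unary.Any using (here)
open import Data.Vec using ([]; _∷_; replicate)
open import Relation.Binary.Definitions using (DecidableEquality)
open import Relation.Binary.PropositionalEquality
open import Relation.Nullary using (yes; no; ¬?)
open import Relation.Nullary.Negation using (contradiction)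

_·_ : ℕ → Bool → Bool
zero · v = false
suc n · v = v xor (n · v)

xor-exchange : ∀ x y z → x xor (y xor z) ≡ y xor (x xor z)
xor-exchange x y z = begin
  x xor (y xor z)  ≡⟨ sym (xor-assoc x y z) ⟩
  (x xor y) xor z  ≡⟨ cong (_xor z) (xor-comm x y) ⟩
  (y xor x) xor z  ≡⟨ xor-assoc y x z ⟩
  y xor (x xor z)  ∎
  where open ≡-Reasoning

·-mod-2 : ∀ n v → n · v ≡ (n % 2) · v
·-mod-2 zero v = refl
·-mod-2 (suc zero) v = refl
·-mod-2 (suc (suc n)) v = begin
  v xor (v xor n · v)  ≡⟨ sym (xor-assoc v v (n · v)) ⟩
  (v xor v) xor n · v  ≡⟨ cong (_xor n · v) (xor-same v) ⟩
  n · v                ≡⟨ ·-mod-2 n v ⟩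
  (n % 2) · v          ∎
  where open ≡-Reasoning

odd·v≡v : ∀ n v → n % 2 ≡ 1 → n · v ≡ v
odd·v≡v n v n-odd = trans (·-mod-2 n v) (trans (cong (_· v) n-odd) (xor-identityʳ v))

even·v≡false : ∀ n v → n % 2 ≡ 0 → n · v ≡ false
even·v≡false n v n-even = trans (·-mod-2 n v) (cong (_· v) n-even)

module Sum𝔽₂ {A B : Set} (_≟_ : DecidableEquality B) (g : A → B) where

  multiplicity : B → List A → ℕ
  multiplicity b L = length (filter (λ c → g c ≟ b) L)

  without : B → List A → List A
  without b = filter (λ c → ¬? (g c ≟ b))

  sum : (B → Bool) → List A → Bool
  sum f = foldr (λ c s → f (g c) xor s) false

  multiplicity-without-self : ∀ x L → multiplicity x (without x L) ≡ 0
  multiplicity-without-self x [] = refl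
  multiplicity-without-self x (c ∷ L) with g c ≟ x
  ... | yes _ = multiplicity-without-self x L
  ... | no gc≢x with g c ≟ x
  ...   | yes gc≡x = contradiction gc≡x gc≢x
  ...   | no _ = multiplicity-without-self x L

  multiplicity-without-other : ∀ {b x} L → b ≢ x → multiplicity b (without x L) ≡ multiplicity b L
  multiplicity-without-other {b} {x} [] b≢x = refl
  multiplicity-without-other {b} {x} (c ∷ L) b≢x with g c ≟ x
  ... | yes gc≡x with g c ≟ b
  ...   | yes gc≡b = contradiction (trans (sym gc≡b) gc≡x) b≢x
  ...   | no _ = multiplicity-without-other L b≢x
  multiplicity-without-other {b} {x} (c ∷ L) b≢x | no _ with g c ≟ b
  ...   | yes _ = cong suc (multiplicity-without-other L b≢x)
  ...   | no _ = multiplicity-without-other L b≢x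

  length-without-head : ∀ c L → length (without (g c) (c ∷ L)) < length (c ∷ L)
  length-without-head c L = filter-notAll (λ c′ → ¬? (g c′ ≟ g c)) (c ∷ L) (here (λ gc≢gc → gc≢gc refl))

  sum-split : ∀ f x L → sum f L ≡ multiplicity x L · f x xor sum f (without x L)
  sum-split f x [] = refl
  sum-split f x (c ∷ L) with g c ≟ x
  ... | yes refl = trans (cong (f (g c) xor_) (sum-split f (g c) L))
                         (sym (xor-assoc (f (g c)) (multiplicity (g c) L · f (g c)) (sum f (without (g c) L))))
  ... | no _ = trans (cong (f (g c) xor_) (sum-split f x L))
                     (xor-exchange (f (g c)) (multiplicity x L · f x) (sum f (without x L)))

  without-even : ∀ x L → (∀ b → b ≢ x → multiplicity b L % 2 ≡ 0) →
                 ∀ b → multiplicity b (without x L) % 2 ≡ 0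
  without-even x L even-off-x b with b ≟ x
  ... | yes refl = cong (_% 2) (multiplicity-without-self x L)
  ... | no b≢x = trans (cong (_% 2) (multiplicity-without-other L b≢x)) (even-off-x b b≢x)

  sum-of-even-multiplicities : ∀ f L → (∀ b → multiplicity b L % 2 ≡ 0) → sum f L ≡ false
  sum-of-even-multiplicities f L all-even = go (length L) L ≤-refl all-even
    where
    go : ∀ n L → length L ≤ n → (∀ b → multiplicity b L % 2 ≡ 0) → sum f L ≡ false
    go n [] _ _ = refl
    go (suc n) (c ∷ L) (s≤s |L|≤n) even = begin
      sum f (c ∷ L)                                           ≡⟨ sum-split f x (c ∷ L) ⟩
      multiplicity x (c ∷ L) · f x xor sum f (without x cL)   ≡⟨ cong (_xor sum f (without x cL)) x-vanishes ⟩
      sum f (without x cL)                                    ≡⟨ go n (without x cL) shorter (without-even x cL (λ b _ → even b)) ⟩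
      false                                                   ∎
      where
      open ≡-Reasoning
      x = g c
      cL = c ∷ L
      x-vanishes : multiplicity x cL · f x ≡ false
      x-vanishes = even·v≡false (multiplicity x cL) (f x) (even x)
      shorter : length (without x cL) ≤ n
      shorter = ≤-trans (≤-pred (length-without-head c L)) |L|≤n

  sum-of-single-odd-multiplicity : ∀ f b₀ L → multiplicity b₀ L % 2 ≡ 1 →
                                   (∀ b → b ≢ b₀ → multiplicity b L % 2 ≡ 0) → sum f L ≡ f b₀
  sum-of-single-odd-multiplicity f b₀ L b₀-odd even-off-b₀ = begin
    sum f L                                             ≡⟨ sum-split f b₀ L ⟩
    multiplicity b₀ L · f b₀ xor sum f (without b₀ L)   ≡⟨ cong₂ _xor_ b₀-survives rest-vanishes ⟩
    f b₀ xor false                                      ≡⟨ xor-identityʳ (f b₀) ⟩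
    f b₀                                                ∎
    where
    open ≡-Reasoning
    b₀-survives : multiplicity b₀ L · f b₀ ≡ f b₀
    b₀-survives = odd·v≡v (multiplicity b₀ L) (f b₀) b₀-odd
    rest-vanishes : sum f (without b₀ L) ≡ false
    rest-vanishes = sum-of-even-multiplicities f (without b₀ L) (without-even b₀ L even-off-b₀)

restrict-replicate : ∀ {A : Set} {d} (K : Subset d) (z : A) → restrict K (replicate d z) ≡ replicate (size K) z
restrict-replicate [] z = refl
restrict-replicate (true ∷ K) z = cong (z ∷_) (restrict-replicate K z)
restrict-replicate (false ∷ K) z = restrict-replicate K z

restrict-fixT-first∈ : ∀ q {d} (K : Subset d) a → first∈ K ≡ true → restrict K (fixT q d a) ≡ fixT q (size K) a
restrict-fixT-first∈ q (true ∷ K) a _ = cong (a ∷_) (restrict-replicate K (0Z q))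

restrict-fixT-first∉ : ∀ q {d} (K : Subset d) a → first∈ K ≡ false → restrict K (fixT q d a) ≡ zeroT q (size K)
restrict-fixT-first∉ q [] a _ = refl
restrict-fixT-first∉ q (false ∷ K) a _ = restrict-replicate K (0Z q)

module _ {k q d : ℕ} {a : Zq q} {Ξ : List (Tuple q d)} (blurer : IsBlurer k q a d Ξ)
         (K : Subset d) (|K|≡k : size K ≡ k) where
  open IsBlurer blurer

  count#-at-fixT : count# q K (restrict K (fixT q d a)) Ξ ≡ 1
  count#-at-fixT with first∈ K in 1∈K
  ... | true = subst (λ b → count# q K b Ξ ≡ 1) (sym (restrict-fixT-first∈ q K a 1∈K)) (cond-1∈N K |K|≡k 1∈K)
  ... | false = subst (λ b → count# q K b Ξ ≡ 1) (sym (restrict-fixT-first∉ q K a 1∈K)) (cond-1∉N K |K|≡k 1∈K)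

  count#-off-fixT : ∀ b → b ≢ restrict K (fixT q d a) → count# q K b Ξ ≡ 0
  count#-off-fixT b b≢fix = cond-other K |K|≡k b
    (λ 1∈K b≡fix → b≢fix (trans b≡fix (sym (restrict-fixT-first∈ q K a 1∈K))))
    (λ 1∉K b≡zero → b≢fix (trans b≡zero (sym (restrict-fixT-first∉ q K a 1∉K))))

mainTheorem7 : (k q d : ℕ) → d ≥ k → (a : Zq q) → (Ξ : List (Tuple q d)) →
               IsBlurer k q a d Ξ →
               (K : Subset d) → size K ≡ k →
               (f : Tuple q (size K) → Bool) →
               sumF2 q K f Ξ ≡ f (restrict K (fixT q d a))
mainTheorem7 k q d _ a Ξ blurer K |K|≡k f =
  sum-of-single-odd-multiplicity f (restrict K (fixT q d a)) Ξ
    (count#-at-fixT blurer K |K|≡k) (count#-off-fixT blurer K |K|≡k)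
  where open Sum𝔽₂ (≟T q) (restrict K)
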